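{- Let $G=G(V,E)$ be a simple graph and $O$ an acyclic orientation of $G$. For an edge $\{u,v\}\in E$ with $(u,v)\in O[E]$, define the orientation $O_{\{u,v\}}$ of $G$ by: for each edge $e=\{x,y\}$ with $(x,y)\in O[E]$, $O_{\{u,v\}}(e)=(y,x)$ if $u\le_O x<_O y\le_O v$, and $O_{\{u,v\}}(e)=(x,y)$ otherwise. Then $O_{\{u,v\}}$ is an acyclic orientation of $G$ and $(O_{\{u,v\}})_{\{u,v\}}=O$. Moreover, for any $e_1,e_2\in E$, $O_{e_1}=O_{e_2}$ if and only if $e_1=e_2$.
   Context: An acyclic orientation $O$ of $G$ orients every edge, with no directed cycle; $O[E]$ is its set of directed edges, and $\le_O$ is the partial order on $V$ it generates ($(x,y)\in O[E]$ implies $x<_O y$). -}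

module Defs where

open import Level using (0ℓ)
open import Data.Nat using (ℕ)
open import Data.Fin using (Fin)
open import Data.Product using (_×_; Σ)
open import Data.Sum using (_⊎_)
open import Data.Empty using (⊥)
open import Relation.Nullary using (¬_)
open import Relation.Binary using (Rel; Decidable)
open import Relation.Binary.PropositionalEquality using (_≡_)
open import Relation.Binary.Construct.Closure.Transitive using (TransClosure)
open import Relation.Binary.Construct.Closure.ReflexiveTransitive using (Star)

record SimpleGraph (n : ℕ) : Set₁ where
  field
    Adj     : Rel (Fin n) 0ℓ
    sym     : ∀ {x y} → Adj x y → Adj y x
    irrefl  : ∀ {x} → ¬ Adj x x
    adj?    : Decidable Adj
open SimpleGraph public

-- An orientation of G, given by its set of directed edges O[E] as a relation:
-- every directed edge comes from an edge, and every edge {x,y} is oriented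
-- in exactly one of the two directions.
record IsOrientation {n : ℕ} (G : SimpleGraph n) (O : Rel (Fin n) 0ℓ) : Set where
  field
    sound    : ∀ {x y} → O x y → Adj G x y
    complete : ∀ {x y} → Adj G x y → O x y ⊎ O y x
    unique   : ∀ {x y} → O x y → O y x → ⊥

Acyclic : {n : ℕ} → Rel (Fin n) 0ℓ → Set
Acyclic O = ∀ x → ¬ TransClosure O x x

record IsAcyclicOrientation {n : ℕ} (G : SimpleGraph n) (O : Rel (Fin n) 0ℓ) : Set where
  field
    orientation : IsOrientation G O
    acyclic     : Acyclic O

_≤[_]_ : {n : ℕ} → Fin n → Rel (Fin n) 0ℓ → Fin n → Set
x ≤[ O ] y = Star O x y

-- Reorientation with respect to a directed edge (u,v) ∈ O[E]:
-- the directed edge (x,y) of O is reversed iff u ≤_O x <_O y ≤_O v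
-- (x <_O y is automatic since (x,y) ∈ O[E]).
-- FlipDir O u v x y  holds iff (x,y) is a directed edge of the new orientation.
FlipDir : {n : ℕ} → Rel (Fin n) 0ℓ → Fin n → Fin n → Rel (Fin n) 0ℓ
FlipDir O u v x y =
    (O y x × (u ≤[ O ] y) × (x ≤[ O ] v))
  ⊎ (O x y × ¬ ((u ≤[ O ] x) × (y ≤[ O ] v)))

-- O_{a,b} for an (unordered) edge {a,b}: use the direction (u,v) of {a,b}
-- that lies in O[E].
Flip : {n : ℕ} → Rel (Fin n) 0ℓ → Fin n → Fin n → Rel (Fin n) 0ℓ
Flip O a b x y = (O a b × FlipDir O a b x y) ⊎ (O b a × FlipDir O b a x y)

_≐_ : {n : ℕ} → Rel (Fin n) 0ℓ → Rel (Fin n) 0ℓ → Set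
O ≐ O' = ∀ x y → (O x y → O' x y) × (O' x y → O x y)

SameEdge : {n : ℕ} → Fin n → Fin n → Fin n → Fin n → Set
SameEdge a b c d = (a ≡ c × b ≡ d) ⊎ (a ≡ d × b ≡ c)

module Submission where

-- Fix an acyclic orientation O and a directed edge (u,v) of O, and write
-- O' = O_{u,v}; O' reverses exactly the O-edges lying in the interval
-- [u,v] of ≤_O.  Two closure properties of O'-paths drive everything:
-- "being above u" (in ≤_O) is preserved forwards along O'-paths and "being
-- below v" backwards; and an O-path inside [u,v] reverses to an O'-path.
-- Hence an O'-cycle either uses no reversed edge (an O-cycle) or lies in
-- [u,v], where all of its edges are reversed (again an O-cycle): O' is
-- acyclic.  The same facts show that the interval [v,u] of ≤_{O'} is the
-- interval [u,v] of ≤_O, so reorienting O' along (v,u) restores O.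
-- Finally (v,u) is an edge of O_{u,v} that forces u and v to be the
-- bounds of the reversed interval, so by antisymmetry of ≤_O the map
-- e ↦ O_e is injective.

open import Defs
open import Level using (0ℓ)
open import Data.Nat using (ℕ)
open import Data.Fin using (Fin; _≟_)
open import Data.Product using (_×_; _,_; proj₁; proj₂; ∃₂)
open import Data.Sum using (_⊎_; inj₁; inj₂)
open import Data.Empty using (⊥; ⊥-elim)
open import Data.List using (List; []; _∷_; allFin)
open import Data.List.Relation.Unary.Any using (here; there)
open import Data.List.Membership.Propositional using (_∈_)
open import Data.List.Membership.Propositional.Properties using (∈-allFin)
open import Relation.Nullary using (¬_; yes; no)
open import Relation.Nullary.Decidable using (_×-dec_; _⊎-dec_; map′)
open import Relation.Binary using (Rel; Decidable)
open import Relation.Binary.PropositionalEquality using (_≡_; refl)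
open import Relation.Binary.Construct.Closure.Transitive using (TransClosure; [_]; _∷_; _∷ʳ_)
open import Relation.Binary.Construct.Closure.ReflexiveTransitive using (Star; ε; _◅_; _◅◅_)

module _ {A : Set} {R : Rel A 0ℓ} where

  plus⇒star : ∀ {a b} → TransClosure R a b → Star R a b
  plus⇒star [ e ]   = e ◅ ε
  plus⇒star (e ∷ p) = e ◅ plus⇒star p

  _◅⁺_ : ∀ {a b c} → R a b → Star R b c → TransClosure R a c
  e ◅⁺ ε       = [ e ]
  e ◅⁺ (f ◅ p) = e ∷ (f ◅⁺ p)

star-antisym : {n : ℕ} {R : Rel (Fin n) 0ℓ} → Acyclic R →
               ∀ {a b} → Star R a b → Star R b a → a ≡ b
star-antisym acyclic ε           _ = refl
star-antisym acyclic {a} (e ◅ p) q = ⊥-elim (acyclic a (e ◅⁺ (p ◅◅ q)))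

-- Reachability for a decidable relation on a finite vertex set is
-- decidable, by the Floyd–Warshall recursion on the set of vertices a path
-- may pass through.
module Reachability {n : ℕ} {R : Rel (Fin n) 0ℓ} (R? : Decidable R) where

  -- Via S a b: b is reachable from a by a path whose intermediate vertices
  -- all lie in S.
  Via : List (Fin n) → Rel (Fin n) 0ℓ
  Via []      a b = a ≡ b ⊎ R a b
  Via (k ∷ S) a b = Via S a b ⊎ (Via S a k × Via S k b)

  via? : ∀ S → Decidable (Via S)
  via? []      a b = (a ≟ b) ⊎-dec R? a b
  via? (k ∷ S) a b = via? S a b ⊎-dec (via? S a k ×-dec via? S k b)

  via⇒star : ∀ S {a b} → Via S a b → Star R a b
  via⇒star []      (inj₁ refl)    = ε
  via⇒star []      (inj₂ e)       = e ◅ ε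
  via⇒star (k ∷ S) (inj₁ p)       = via⇒star S p
  via⇒star (k ∷ S) (inj₂ (p , q)) = via⇒star S p ◅◅ via⇒star S q

  direct⇒via : ∀ S {a b} → Via [] a b → Via S a b
  direct⇒via []      p = p
  direct⇒via (k ∷ S) p = inj₁ (direct⇒via S p)

  via-trans : ∀ S {a m b} → m ∈ S → Via S a m → Via S m b → Via S a b
  via-trans (k ∷ S) (here refl) p q = inj₂ (into-k p , out-of-k q)
    where
      -- a path ending (resp. starting) at k need not pass through k
      into-k : ∀ {a} → Via (k ∷ S) a k → Via S a k
      into-k (inj₁ p)       = p
      into-k (inj₂ (p , _)) = p
      out-of-k : ∀ {b} → Via (k ∷ S) k b → Via S k b
      out-of-k (inj₁ q)       = q
      out-of-k (inj₂ (_ , q)) = q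
  via-trans (k ∷ S) (there m∈S) (inj₁ p)       (inj₁ q)       = inj₁ (via-trans S m∈S p q)
  via-trans (k ∷ S) (there m∈S) (inj₁ p)       (inj₂ (q , r)) = inj₂ (via-trans S m∈S p q , r)
  via-trans (k ∷ S) (there m∈S) (inj₂ (p , q)) (inj₁ r)       = inj₂ (p , via-trans S m∈S q r)
  via-trans (k ∷ S) (there m∈S) (inj₂ (p , _)) (inj₂ (_ , r)) = inj₂ (p , r)

  star⇒via : ∀ {a b} → Star R a b → Via (allFin n) a b
  star⇒via ε = direct⇒via (allFin n) (inj₁ refl)
  star⇒via (_◅_ {j = c} e p) =
    via-trans (allFin n) (∈-allFin c) (direct⇒via (allFin n) (inj₂ e)) (star⇒via p)

  star? : Decidable (Star R)
  star? a b = map′ (via⇒star (allFin n)) star⇒via (via? (allFin n) a b)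

module _ {n : ℕ} {G : SimpleGraph n} {O : Rel (Fin n) 0ℓ} (isO : IsOrientation G O) where
  open IsOrientation isO

  orientation-dec : Decidable O
  orientation-dec a b with adj? G a b
  ... | no ¬ab = no λ o → ¬ab (sound o)
  ... | yes ab with complete ab
  ...   | inj₁ o  = yes o
  ...   | inj₂ o′ = no λ o → unique o o′

  oriented-endpoints : ∀ {a b} → Adj G a b → ∃₂ λ u v → O u v × SameEdge a b u v
  oriented-endpoints {a} {b} ab with complete ab
  ... | inj₁ o = a , b , o , inj₁ (refl , refl)
  ... | inj₂ o = b , a , o , inj₂ (refl , refl)

module _ {n : ℕ} where

  ≐-refl : {R : Rel (Fin n) 0ℓ} → R ≐ R
  ≐-refl x y = (λ r → r) , (λ r → r)

  ≐-sym : {R S : Rel (Fin n) 0ℓ} → R ≐ S → S ≐ R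
  ≐-sym R≐S x y = proj₂ (R≐S x y) , proj₁ (R≐S x y)

  ≐-trans : {R S T : Rel (Fin n) 0ℓ} → R ≐ S → S ≐ T → R ≐ T
  ≐-trans R≐S S≐T x y =
    (λ r → proj₁ (S≐T x y) (proj₁ (R≐S x y) r)) , (λ t → proj₂ (R≐S x y) (proj₂ (S≐T x y) t))

  SameEdge-sym : {a b c d : Fin n} → SameEdge a b c d → SameEdge c d a b
  SameEdge-sym (inj₁ (refl , refl)) = inj₁ (refl , refl)
  SameEdge-sym (inj₂ (refl , refl)) = inj₂ (refl , refl)

  SameEdge-trans : {a b c d e f : Fin n} →
                   SameEdge a b c d → SameEdge c d e f → SameEdge a b e f
  SameEdge-trans (inj₁ (refl , refl)) q                    = q
  SameEdge-trans (inj₂ (refl , refl)) (inj₁ (refl , refl)) = inj₂ (refl , refl)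
  SameEdge-trans (inj₂ (refl , refl)) (inj₂ (refl , refl)) = inj₁ (refl , refl)

  SameEdge⇒Flip≐ : {R : Rel (Fin n) 0ℓ} {a b c d : Fin n} →
                   SameEdge a b c d → Flip R a b ≐ Flip R c d
  SameEdge⇒Flip≐ (inj₁ (refl , refl)) = ≐-refl
  SameEdge⇒Flip≐ (inj₂ (refl , refl)) x y = swap , swap
    where
      swap : ∀ {P Q : Set} → P ⊎ Q → Q ⊎ P
      swap (inj₁ p) = inj₂ p
      swap (inj₂ q) = inj₁ q

  fromFlip : {R : Rel (Fin n) 0ℓ} {u v x y : Fin n} →
             ¬ R v u → Flip R u v x y → FlipDir R u v x y
  fromFlip ¬vu (inj₁ (_ , d))  = d
  fromFlip ¬vu (inj₂ (vu , _)) = ⊥-elim (¬vu vu)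

  toFlip : {R : Rel (Fin n) 0ℓ} {u v x y : Fin n} →
           R u v → FlipDir R u v x y → Flip R u v x y
  toFlip uv d = inj₁ (uv , d)

module Reorientation {n : ℕ} {G : SimpleGraph n} {O : Rel (Fin n) 0ℓ}
                     (ao : IsAcyclicOrientation G O) {u v : Fin n} (uv : O u v) where
  open IsAcyclicOrientation ao
  open IsOrientation orientation
  open Reachability (orientation-dec orientation) using (star?)

  O′ : Rel (Fin n) 0ℓ
  O′ = Flip O u v

  view : ∀ {x y} → O′ x y → FlipDir O u v x y
  view = fromFlip (unique uv)

  reversed : ∀ {x y} → O x y → u ≤[ O ] x → y ≤[ O ] v → O′ y x
  reversed o ux yv = toFlip uv (inj₁ (o , ux , yv))

  kept : ∀ {x y} → O x y → ¬ (u ≤[ O ] x × y ≤[ O ] v) → O′ x y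
  kept o out = toFlip uv (inj₂ (o , out))

  above-u : ∀ {a b} → u ≤[ O ] a → Star O′ a b → u ≤[ O ] b
  above-u ua ε = ua
  above-u ua (e ◅ p) with view e
  ... | inj₁ (_ , ub , _) = above-u ub p
  ... | inj₂ (o , _)      = above-u (ua ◅◅ (o ◅ ε)) p

  below-v : ∀ {a b} → Star O′ a b → b ≤[ O ] v → a ≤[ O ] v
  below-v ε bv = bv
  below-v (e ◅ p) bv with view e
  ... | inj₁ (_ , _ , av) = av
  ... | inj₂ (o , _)      = o ◅ below-v p bv

  reverse-interval : ∀ {a b} → Star O a b → u ≤[ O ] a → b ≤[ O ] v → Star O′ b a
  reverse-interval ε       _  _  = ε
  reverse-interval (o ◅ p) ua bv =
    reverse-interval p (ua ◅◅ (o ◅ ε)) bv ◅◅ (reversed o ua (p ◅◅ bv) ◅ ε)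

  path-cases : ∀ {a b} → TransClosure O′ a b →
               TransClosure O a b ⊎ (a ≤[ O ] v × u ≤[ O ] b)
  path-cases [ e ] with view e
  ... | inj₁ (_ , ub , av) = inj₂ (av , ub)
  ... | inj₂ (o , _)       = inj₁ [ o ]
  path-cases (e ∷ p) with view e
  ... | inj₁ (_ , ub , av) = inj₂ (av , above-u ub (plus⇒star p))
  ... | inj₂ (o , _) with path-cases p
  ...   | inj₁ q         = inj₁ (o ∷ q)
  ...   | inj₂ (bv , uc) = inj₂ (o ◅ bv , uc)

  reversed-step : ∀ {a b} → O′ a b → u ≤[ O ] a → b ≤[ O ] v → O b a
  reversed-step e ua bv with view e
  ... | inj₁ (o , _)   = o
  ... | inj₂ (_ , out) = ⊥-elim (out (ua , bv))

  reversed-path : ∀ {a b} → TransClosure O′ a b → u ≤[ O ] a → b ≤[ O ] v →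
                  TransClosure O b a
  reversed-path [ e ]   ua bv = [ reversed-step e ua bv ]
  reversed-path (e ∷ p) ua cv =
    reversed-path p (above-u ua (e ◅ ε)) cv ∷ʳ reversed-step e ua (below-v (plus⇒star p) cv)

  acyclic′ : Acyclic O′
  acyclic′ x cycle with path-cases cycle
  ... | inj₁ O-cycle  = acyclic x O-cycle
  ... | inj₂ (xv , ux) = acyclic x (reversed-path cycle ux xv)

  orientation′ : IsOrientation G O′
  orientation′ = record { sound = sound′ ; complete = complete′ ; unique = unique′ }
    where
      sound′ : ∀ {x y} → O′ x y → Adj G x y
      sound′ e with view e
      ... | inj₁ (o , _) = SimpleGraph.sym G (sound o)
      ... | inj₂ (o , _) = sound o

      orient : ∀ {x y} → O x y → O′ x y ⊎ O′ y x
      orient {x} {y} o with star? u x ×-dec star? y v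
      ... | yes (ux , yv) = inj₂ (reversed o ux yv)
      ... | no out        = inj₁ (kept o out)

      complete′ : ∀ {x y} → Adj G x y → O′ x y ⊎ O′ y x
      complete′ xy with complete xy
      ... | inj₁ o = orient o
      ... | inj₂ o with orient o
      ...   | inj₁ e = inj₂ e
      ...   | inj₂ e = inj₁ e

      unique′ : ∀ {x y} → O′ x y → O′ y x → ⊥
      unique′ e f with view e | view f
      ... | inj₁ (o , _)       | inj₁ (o′ , _)      = unique o o′
      ... | inj₁ (_ , uy , xv) | inj₂ (_ , out)     = out (uy , xv)
      ... | inj₂ (_ , out)     | inj₁ (_ , ux , yv) = out (ux , yv)
      ... | inj₂ (o , _)       | inj₂ (o′ , _)      = unique o o′

  isAcyclic′ : IsAcyclicOrientation G O′
  isAcyclic′ = record { orientation = orientation′ ; acyclic = acyclic′ }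

  u≤v : u ≤[ O ] v
  u≤v = uv ◅ ε

  vu′ : O′ v u
  vu′ = reversed uv ε ε

  -- Reversing O′ along its edge (v,u) gives back O, because the interval
  -- [v,u] of ≤_{O′} is the interval [u,v] of ≤_O.
  reverse-back : FlipDir O′ v u ≐ O
  reverse-back x y = to , from
    where
      to : FlipDir O′ v u x y → O x y
      to (inj₁ (e , vy , xu)) with view e
      ... | inj₁ (o , _)   = o
      ... | inj₂ (_ , out) = ⊥-elim (out (above-u u≤v vy , below-v xu u≤v))
      to (inj₂ (e , out′)) with view e
      ... | inj₂ (o , _)       = o
      ... | inj₁ (o , uy , xv) =
        ⊥-elim (out′ (reverse-interval xv (uy ◅◅ (o ◅ ε)) ε , reverse-interval uy ε (o ◅ xv)))

      from : O x y → FlipDir O′ v u x y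
      from o with star? u x ×-dec star? y v
      ... | yes (ux , yv) = inj₁ (reversed o ux yv ,
              reverse-interval yv (ux ◅◅ (o ◅ ε)) ε , reverse-interval ux ε (o ◅ yv))
      ... | no out = inj₂ (kept o out ,
              λ { (vx , yu) → out (above-u u≤v vx , below-v yu u≤v) })

  involution : Flip O′ u v ≐ O
  involution = ≐-trans (SameEdge⇒Flip≐ (inj₂ (refl , refl))) (≐-trans as-FlipDir reverse-back)
    where
      as-FlipDir : Flip O′ v u ≐ FlipDir O′ v u
      as-FlipDir x y = fromFlip (IsOrientation.unique orientation′ vu′) , toFlip vu′

module _ {n : ℕ} {G : SimpleGraph n} {O : Rel (Fin n) 0ℓ} (ao : IsAcyclicOrientation G O) where
  open IsAcyclicOrientation ao
  open IsOrientation orientation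

  reversed-in-interval : ∀ {a b c d} → O a b → O c d → Flip O c d b a →
                         c ≤[ O ] a × b ≤[ O ] d
  reversed-in-interval ab cd e with fromFlip (unique cd) e
  ... | inj₁ (_ , ca , bd) = ca , bd
  ... | inj₂ (ba , _)      = ⊥-elim (unique ab ba)

  -- O_{u,v} determines the directed edge (u,v): each of (u,v), (c,d) lies
  -- in the reversed interval of the other.
  Flip-injective-directed : ∀ {u v c d} → O u v → O c d →
                            Flip O u v ≐ Flip O c d → u ≡ c × v ≡ d
  Flip-injective-directed {u} {v} {c} {d} uv cd eq
    with reversed-in-interval uv cd (proj₁ (eq v u) (Reorientation.vu′ ao uv))
       | reversed-in-interval cd uv (proj₂ (eq d c) (Reorientation.vu′ ao cd))
  ... | (cu , vd) | (uc , dv) = star-antisym acyclic uc cu , star-antisym acyclic vd dv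

  Flip-injective : ∀ {a b c d} → Adj G a b → Adj G c d →
                   Flip O a b ≐ Flip O c d → SameEdge a b c d
  Flip-injective ab cd eq
    with oriented-endpoints orientation ab | oriented-endpoints orientation cd
  ... | u , v , uv , ab~uv | u′ , v′ , uv′ , cd~uv′
    with Flip-injective-directed uv uv′
           (≐-trans (≐-sym (SameEdge⇒Flip≐ ab~uv)) (≐-trans eq (SameEdge⇒Flip≐ cd~uv′)))
  ...   | refl , refl = SameEdge-trans ab~uv (SameEdge-sym cd~uv′)

lemma5p13 : (n : ℕ) (G : SimpleGraph n) (O : Rel (Fin n) 0ℓ) →
    IsAcyclicOrientation G O →
    ((u v : Fin n) → O u v →
    IsAcyclicOrientation G (Flip O u v) × (Flip (Flip O u v) u v ≐ O))
    × ((a b c d : Fin n) → Adj G a b → Adj G c d →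
    (Flip O a b ≐ Flip O c d → SameEdge a b c d)
    × (SameEdge a b c d → Flip O a b ≐ Flip O c d))
lemma5p13 n G O ao =
  (λ u v uv → Reorientation.isAcyclic′ ao uv , Reorientation.involution ao uv) ,
  (λ a b c d ab cd → Flip-injective ao ab cd , SameEdge⇒Flip≐)
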